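{- Let $G$ be the disjoint union of the complete graphs $K_m$ and $K_n$ with $m\ge n\ge 1$. Then $G$ is $(1,2)$-step competition-realizable if and only if $n\neq 2$.
   Context: For vertices $x,y$ of a digraph $H$, $d_H(x,y)$ is the length of a shortest directed $(x,y)$-path. The $(1,2)$-step competition graph $C_{1,2}(D)$ of a digraph $D$ is the simple graph on $V(D)$ in which distinct $u,v$ are adjacent iff there is $w\neq u,v$ with either $d_{D-v}(u,w)\le 1$ and $d_{D-u}(v,w)\le 2$, or $d_{D-u}(v,w)\le 1$ and $d_{D-v}(u,w)\le 2$. A graph is $(1,2)$-step competition-realizable if it is isomorphic to $C_{1,2}(D)$ for some orientation $D$ of a complete bipartite graph $K_{p,q}$ with $p,q\ge1$. -}

module Defs where

open import Level using (0ℓ)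
open import Data.Nat using (ℕ; _≤_)
open import Data.Fin using (Fin)
open import Data.Bool using (Bool; true; false)
open import Data.Sum using (_⊎_; inj₁; inj₂)
open import Data.Product using (Σ; ∃; ∃-syntax; _×_; _,_)
open import Data.Empty using (⊥)
open import Relation.Binary.PropositionalEquality using (_≡_; _≢_)
open import Function.Bundles using (_↔_; Inverse; _⇔_)

BVert : ℕ → ℕ → Set
BVert p q = Fin p ⊎ Fin q

-- An orientation of K_{p,q}: for each edge {i,j} (i in part 1, j in part 2),
-- true means the arc i → j, false means the arc j → i.
Orientation : ℕ → ℕ → Set
Orientation p q = Fin p → Fin q → Bool

Arc : ∀ {p q} → Orientation p q → BVert p q → BVert p q → Set
Arc o (inj₁ i) (inj₂ j) = o i j ≡ true
Arc o (inj₂ j) (inj₁ i) = o i j ≡ false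
Arc o (inj₁ _) (inj₁ _) = ⊥
Arc o (inj₂ _) (inj₂ _) = ⊥

-- For distinct a, w, both different from z:  d_{D-z}(a,w) ≤ 1,
-- i.e. there is an arc a → w.
Dist≤1Avoid : ∀ {p q} → Orientation p q → (z a w : BVert p q) → Set
Dist≤1Avoid o z a w = Arc o a w

-- For distinct a, w, both different from z:  d_{D-z}(a,w) ≤ 2,
-- i.e. an arc a → w, or a directed path a → x → w with x ≠ z.
Dist≤2Avoid : ∀ {p q} → Orientation p q → (z a w : BVert p q) → Set
Dist≤2Avoid o z a w =
  Arc o a w ⊎ (∃[ x ] (x ≢ z × Arc o a x × Arc o x w))

C12Adj : ∀ {p q} → Orientation p q → BVert p q → BVert p q → Set
C12Adj o u v =
  u ≢ v ×
  (∃[ w ] (w ≢ u × w ≢ v ×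
     ((Dist≤1Avoid o v u w × Dist≤2Avoid o u v w)
      ⊎ (Dist≤1Avoid o u v w × Dist≤2Avoid o v u w))))

Realizable : (V : Set) → (V → V → Set) → Set
Realizable V Adj =
  ∃[ p ] ∃[ q ] (1 ≤ p × 1 ≤ q ×
    Σ (Orientation p q) λ o →
    Σ (V ↔ BVert p q) λ f →
      ∀ x y → Adj x y ⇔ C12Adj o (Inverse.to f x) (Inverse.to f y))

KmKnAdj : (m n : ℕ) → Fin m ⊎ Fin n → Fin m ⊎ Fin n → Set
KmKnAdj m n (inj₁ a) (inj₁ b) = a ≢ b
KmKnAdj m n (inj₂ a) (inj₂ b) = a ≢ b
KmKnAdj m n (inj₁ _) (inj₂ _) = ⊥
KmKnAdj m n (inj₂ _) (inj₁ _) = ⊥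

-- In an orientation of K_{p,q} an arc changes sides and a directed 2-path does not.  Let
-- u ~ v be a whole component of C₁,₂(D) where every vertex of D has an out-neighbour.  If u
-- and v lie on different sides, the path witnessing u ~ v exhibits a third competitor of u
-- or of v.  If they lie on the same side they share an out-neighbour w, and for any path
-- w → z → y either z competes with u for y, or y competes with v for w via y → u → w.  So
-- K_m ∪ K_2 with m ≥ 2 is not realizable.  Conversely, orienting K_{m,1} towards its single
-- vertex gives K_m ∪ K_1, and for m, n ≥ 3 the cyclic orientation a₁ → S → a₀ → T → a₁ of
-- K_{2,(m-1)+(n-1)}, with |S| = m - 1 ≥ 2 and |T| = n - 1 ≥ 2, has competition classes
-- {a₁} ∪ S and {a₀} ∪ T.
module Submission where

open import Defs
open import Data.Nat using (ℕ; zero; suc; _+_; _≤_; s≤s; z≤n)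
open import Data.Fin using (Fin; zero; suc; splitAt; _↑ˡ_; _↑ʳ_)
open import Data.Fin.Properties
  using (splitAt-↑ˡ; splitAt-↑ʳ; splitAt⁻¹-↑ˡ; splitAt⁻¹-↑ʳ; ↑ˡ-injective; ↑ʳ-injective)
open import Data.Bool using (Bool; true; false; not; _≟_)
open import Data.Bool.Properties using (not-injective; not-involutive; not-¬)
open import Data.Sum as Sum using (_⊎_; inj₁; inj₂; [_,_]′)
open import Data.Sum.Properties using (inj₁-injective; inj₂-injective)
open import Data.Product using (∃; ∃-syntax; _×_; _,_; proj₁; proj₂)
open import Data.Empty using (⊥)
open import Function using (_∘_)
open import Function.Bundles using (_↔_; Inverse; Injection; _⇔_; Equivalence; mk⇔; mk↔ₛ′)
open import Function.Properties.Inverse using (↔⇒↣; ↔-refl)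
import Function.Properties.Equivalence as ⇔
open import Relation.Nullary using (¬_; yes; no; contradiction)
open import Relation.Binary.PropositionalEquality

isInj₁ : {A B : Set} → A ⊎ B → Bool
isInj₁ (inj₁ _) = true
isInj₁ (inj₂ _) = false

SoleNeighbour : {V : Set} → (V → V → Set) → V → V → Set
SoleNeighbour Adj u v = ∀ t → Adj u t → t ≡ v

SameClass : {V : Set} → (V → Bool) → V → V → Set
SameClass κ x y = x ≢ y × κ x ≡ κ y

partner : ∀ {k} → Fin (suc (suc k)) → Fin (suc (suc k))
partner zero    = suc zero
partner (suc _) = zero

partner-≢ : ∀ {k} (i : Fin (suc (suc k))) → partner i ≢ i
partner-≢ zero    ()
partner-≢ (suc _) ()

module _ {p q : ℕ} (o : Orientation p q) where

  arc-flips-side : ∀ {a b} → Arc o a b → isInj₁ b ≡ not (isInj₁ a)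
  arc-flips-side {inj₁ _} {inj₂ _} _ = refl
  arc-flips-side {inj₂ _} {inj₁ _} _ = refl

  arc⇒side≢ : ∀ {a b} → Arc o a b → isInj₁ a ≢ isInj₁ b
  arc⇒side≢ ab a≡b = not-¬ (sym a≡b) (arc-flips-side ab)

  arc⇒≢ : ∀ {a b} → Arc o a b → a ≢ b
  arc⇒≢ ab refl = arc⇒side≢ ab refl

  arc-asym : ∀ {a b} → Arc o a b → Arc o b a → ⊥
  arc-asym {inj₁ i} {inj₂ j} ab ba with () ← trans (sym ab) ba
  arc-asym {inj₂ j} {inj₁ i} ab ba with () ← trans (sym ab) ba

  arc-total : ∀ {a b} → isInj₁ a ≢ isInj₁ b → Arc o a b ⊎ Arc o b a
  arc-total {inj₁ _} {inj₁ _} a≢b = contradiction refl a≢b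
  arc-total {inj₂ _} {inj₂ _} a≢b = contradiction refl a≢b
  arc-total {inj₁ i} {inj₂ j} _ with o i j
  ... | true  = inj₁ refl
  ... | false = inj₂ refl
  arc-total {inj₂ j} {inj₁ i} _ with o i j
  ... | true  = inj₂ refl
  ... | false = inj₁ refl

  common-target⇒same-side : ∀ {a b w} → Arc o a w → Arc o b w → isInj₁ a ≡ isInj₁ b
  common-target⇒same-side aw bw = not-injective (trans (sym (arc-flips-side aw)) (arc-flips-side bw))

  path₂⇒same-side : ∀ {a x b} → Arc o a x → Arc o x b → isInj₁ a ≡ isInj₁ b
  path₂⇒same-side {a} ax xb = begin
    isInj₁ a             ≡⟨ not-involutive (isInj₁ a) ⟨
    not (not (isInj₁ a)) ≡⟨ cong not (arc-flips-side ax) ⟨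
    not (isInj₁ _)       ≡⟨ arc-flips-side xb ⟨
    isInj₁ _             ∎
    where open ≡-Reasoning

  no-transitive-triangle : ∀ {a b c} → Arc o a b → Arc o a c → Arc o b c → ⊥
  no-transitive-triangle ab ac bc = arc⇒side≢ ab (common-target⇒same-side ac bc)

  C12Adj-sym : ∀ {u v} → C12Adj o u v → C12Adj o v u
  C12Adj-sym (u≢v , w , w≢u , w≢v , inj₁ h) = u≢v ∘ sym , w , w≢v , w≢u , inj₂ h
  C12Adj-sym (u≢v , w , w≢u , w≢v , inj₂ h) = u≢v ∘ sym , w , w≢v , w≢u , inj₁ h

  common-target⇒C12Adj : ∀ {a b w} → a ≢ b → Arc o a w → Arc o b w → C12Adj o a b
  common-target⇒C12Adj a≢b aw bw =
    a≢b , _ , arc⇒≢ aw ∘ sym , arc⇒≢ bw ∘ sym , inj₁ (aw , inj₁ bw)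

  two-step⇒C12Adj : ∀ {a b w x} → a ≢ b → Arc o a w →
                    x ≢ a → Arc o b x → Arc o x w → C12Adj o a b
  two-step⇒C12Adj a≢b aw x≢a bx xw =
    a≢b , _ , arc⇒≢ aw ∘ sym , (λ { refl → arc-asym bx xw }) , inj₁ (aw , inj₂ (_ , x≢a , bx , xw))

  C12Adj⇒out-arc : ∀ {a b} → C12Adj o a b → ∃[ w ] Arc o a w
  C12Adj⇒out-arc (_ , w , _ , _ , inj₁ (aw , _))                  = w , aw
  C12Adj⇒out-arc (_ , w , _ , _ , inj₂ (_ , inj₁ aw))             = w , aw
  C12Adj⇒out-arc (_ , _ , _ , _ , inj₂ (_ , inj₂ (x , _ , ax , _))) = x , ax

  same-side-C12Adj⇒common-target : ∀ {u v} → isInj₁ u ≡ isInj₁ v → C12Adj o u v →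
                                   ∃[ w ] (Arc o u w × Arc o v w)
  same-side-C12Adj⇒common-target _ (_ , w , _ , _ , inj₁ (uw , inj₁ vw)) = w , uw , vw
  same-side-C12Adj⇒common-target _ (_ , w , _ , _ , inj₂ (vw , inj₁ uw)) = w , uw , vw
  same-side-C12Adj⇒common-target u≡v (_ , _ , _ , _ , inj₁ (uw , inj₂ (_ , _ , vx , xw))) =
    contradiction (trans u≡v (path₂⇒same-side vx xw)) (arc⇒side≢ uw)
  same-side-C12Adj⇒common-target u≡v (_ , _ , _ , _ , inj₂ (vw , inj₂ (_ , _ , ux , xw))) =
    contradiction (trans (sym u≡v) (path₂⇒same-side ux xw)) (arc⇒side≢ vw)

  no-sole-pair-below-path₃ : ∀ {u v w z y} → u ≢ v → Arc o u w → Arc o v w → Arc o w z → Arc o z y →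
                             SoleNeighbour (C12Adj o) u v → SoleNeighbour (C12Adj o) v u → ⊥
  no-sole-pair-below-path₃ {u} {v} {w} {z} {y} u≢v uw vw wz zy Nu Nv =
    [ z-competes-with-u , y-competes-with-v ]′ (arc-total u≁y)
    where
    u≁y : isInj₁ u ≢ isInj₁ y
    u≁y u≡y = arc⇒side≢ zy (trans (sym (path₂⇒same-side uw wz)) u≡y)

    z-competes-with-u : Arc o u y → ⊥
    z-competes-with-u uy = arc-asym vw (subst (Arc o w) (Nu z (common-target⇒C12Adj u≢z uy zy)) wz)
      where
      u≢z : u ≢ z
      u≢z refl = arc-asym uw wz

    y-competes-with-v : Arc o y u → ⊥
    y-competes-with-v yu = arc⇒≢ yu (Nv y (two-step⇒C12Adj v≢y vw u≢v yu uw))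
      where
      v≢y : v ≢ y
      v≢y refl = arc⇒side≢ zy (sym (path₂⇒same-side vw wz))

  sole-neighbour-across : ∀ {u v} → Arc o u v → SoleNeighbour (C12Adj o) u v → ¬ C12Adj o u v
  sole-neighbour-across uv Nu (_ , _ , _ , _ , inj₁ (uw , inj₁ vw)) = no-transitive-triangle uv uw vw
  sole-neighbour-across uv Nu (_ , _ , _ , _ , inj₂ (vw , inj₁ uw)) = no-transitive-triangle uv uw vw
  sole-neighbour-across uv Nu (_ , _ , _ , _ , inj₁ (uw , inj₂ (y , y≢u , vy , yw))) =
    arc⇒≢ vy (sym (Nu y (common-target⇒C12Adj (y≢u ∘ sym) uw yw)))
  sole-neighbour-across uv Nu (_ , _ , _ , _ , inj₂ (vw , inj₂ (y , y≢v , uy , yw))) =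
    y≢v (Nu y (C12Adj-sym (two-step⇒C12Adj (arc⇒≢ uy ∘ sym) yw (y≢v ∘ sym) uv vw)))

  sole-neighbours-same-side : (∀ t → ∃[ w ] Arc o t w) → ∀ {u v} → isInj₁ u ≡ isInj₁ v →
                              SoleNeighbour (C12Adj o) u v → SoleNeighbour (C12Adj o) v u → ¬ C12Adj o u v
  sole-neighbours-same-side out u∼v Nu Nv uv
    with w , uw , vw ← same-side-C12Adj⇒common-target u∼v uv
    with z , wz ← out w
    with y , zy ← out z
    = no-sole-pair-below-path₃ (proj₁ uv) uw vw wz zy Nu Nv

  no-isolated-C12Adj-edge : (∀ t → ∃[ w ] Arc o t w) → ∀ {u v} →
                            SoleNeighbour (C12Adj o) u v → SoleNeighbour (C12Adj o) v u → ¬ C12Adj o u v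
  no-isolated-C12Adj-edge out {u} {v} Nu Nv uv with isInj₁ u ≟ isInj₁ v
  ... | yes u∼v = sole-neighbours-same-side out u∼v Nu Nv uv
  ... | no u≁v with arc-total u≁v
  ...   | inj₁ u→v = sole-neighbour-across u→v Nu uv
  ...   | inj₂ v→u = sole-neighbour-across v→u Nv (C12Adj-sym uv)

¬Realizable-with-isolated-edge : ∀ {V : Set} {Adj : V → V → Set} {u v : V} →
  (∀ x → ∃ (Adj x)) → Adj u v → SoleNeighbour Adj u v → SoleNeighbour Adj v u → ¬ Realizable V Adj
¬Realizable-with-isolated-edge {Adj = Adj} no-isolated uv Nu Nv (_ , _ , _ , _ , o , f , Adj⇔C12Adj) =
  no-isolated-C12Adj-edge o out (sole Nu) (sole Nv) (preserve uv)
  where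
  open Inverse f
  preserve : ∀ {x y} → Adj x y → C12Adj o (to x) (to y)
  preserve {x} {y} = Equivalence.to (Adj⇔C12Adj x y)
  reflect : ∀ {x} b → C12Adj o (to x) b → Adj x (from b)
  reflect {x} b h = Equivalence.from (Adj⇔C12Adj x (from b))
    (subst (C12Adj o (to x)) (sym (strictlyInverseˡ b)) h)
  sole : ∀ {x y} → SoleNeighbour Adj x y → SoleNeighbour (C12Adj o) (to x) (to y)
  sole N b h = trans (sym (strictlyInverseˡ b)) (cong to (N (from b) (reflect b h)))
  out : ∀ b → ∃[ w ] Arc o b w
  out b with y , xy ← no-isolated (from b) =
    C12Adj⇒out-arc o (subst (λ a → C12Adj o a (to y)) (strictlyInverseˡ b) (preserve xy))

KmKnAdj-no-isolated : ∀ {m n} → 2 ≤ m → 2 ≤ n → ∀ x → ∃ (KmKnAdj m n x)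
KmKnAdj-no-isolated (s≤s (s≤s _)) _ (inj₁ i) = inj₁ (partner i) , partner-≢ i ∘ sym
KmKnAdj-no-isolated _ (s≤s (s≤s _)) (inj₂ j) = inj₂ (partner j) , partner-≢ j ∘ sym

KmK2-sole₀ : ∀ {m} → SoleNeighbour (KmKnAdj m 2) (inj₂ zero) (inj₂ (suc zero))
KmK2-sole₀ (inj₂ zero)       0≢0 = contradiction refl 0≢0
KmK2-sole₀ (inj₂ (suc zero)) _   = refl

KmK2-sole₁ : ∀ {m} → SoleNeighbour (KmKnAdj m 2) (inj₂ (suc zero)) (inj₂ zero)
KmK2-sole₁ (inj₂ zero)       _   = refl
KmK2-sole₁ (inj₂ (suc zero)) 1≢1 = contradiction refl 1≢1

KmK2-unrealizable : ∀ m → 2 ≤ m → ¬ Realizable (Fin m ⊎ Fin 2) (KmKnAdj m 2)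
KmK2-unrealizable m 2≤m =
  ¬Realizable-with-isolated-edge (KmKnAdj-no-isolated 2≤m (s≤s (s≤s z≤n))) (λ ()) KmK2-sole₀ KmK2-sole₁

KmKnAdj⇔SameClass : ∀ {m n} x y → KmKnAdj m n x y ⇔ SameClass isInj₁ x y
KmKnAdj⇔SameClass (inj₁ a) (inj₁ b) = mk⇔ (λ a≢b → a≢b ∘ inj₁-injective , refl) (λ (x≢y , _) → x≢y ∘ cong inj₁)
KmKnAdj⇔SameClass (inj₂ a) (inj₂ b) = mk⇔ (λ a≢b → a≢b ∘ inj₂-injective , refl) (λ (x≢y , _) → x≢y ∘ cong inj₂)
KmKnAdj⇔SameClass (inj₁ a) (inj₂ b) = mk⇔ (λ ()) (λ ())
KmKnAdj⇔SameClass (inj₂ a) (inj₁ b) = mk⇔ (λ ()) (λ ())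

SameClass-transport : ∀ {A B : Set} (f : A ↔ B) (κ : A → Bool) (μ : B → Bool) →
  (∀ x → μ (Inverse.to f x) ≡ κ x) → ∀ x y → SameClass κ x y ⇔ SameClass μ (Inverse.to f x) (Inverse.to f y)
SameClass-transport f κ μ μ∘f≗κ x y = mk⇔
  (λ (x≢y , κx≡κy) → x≢y ∘ Injection.injective (↔⇒↣ f) , trans (μ∘f≗κ x) (trans κx≡κy (sym (μ∘f≗κ y))))
  (λ (fx≢fy , μfx≡μfy) → fx≢fy ∘ cong (Inverse.to f) , trans (sym (μ∘f≗κ x)) (trans μfx≡μfy (μ∘f≗κ y)))

realizable-if-C12Adj-is-SameClass : ∀ {m n p q} → 1 ≤ p → 1 ≤ q → (o : Orientation p q) (κ : BVert p q → Bool)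
  (f : (Fin m ⊎ Fin n) ↔ BVert p q) → (∀ x → κ (Inverse.to f x) ≡ isInj₁ x) →
  (∀ a b → C12Adj o a b ⇔ SameClass κ a b) → Realizable (Fin m ⊎ Fin n) (KmKnAdj m n)
realizable-if-C12Adj-is-SameClass 1≤p 1≤q o κ f κ∘f≗isInj₁ C12Adj⇔SameClass =
  _ , _ , 1≤p , 1≤q , o , f , λ x y →
    ⇔.trans (KmKnAdj⇔SameClass x y)
      (⇔.trans (SameClass-transport f isInj₁ κ κ∘f≗isInj₁ x y) (⇔.sym (C12Adj⇔SameClass _ _)))

module Sink (m : ℕ) where

  sink : Orientation m 1
  sink _ _ = true

  out-arc⇒inj₁ : ∀ {a w} → Arc sink a w → isInj₁ a ≡ true
  out-arc⇒inj₁ {inj₁ _} _ = refl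
  out-arc⇒inj₁ {inj₂ _} {inj₁ _} ()

  C12Adj⇔SameClass : ∀ a b → C12Adj sink a b ⇔ SameClass isInj₁ a b
  C12Adj⇔SameClass a b = mk⇔
    (λ ab → proj₁ ab , trans (out-arc⇒inj₁ (proj₂ (C12Adj⇒out-arc sink ab)))
                             (sym (out-arc⇒inj₁ (proj₂ (C12Adj⇒out-arc sink (C12Adj-sym sink ab))))))
    (SameClass⇒C12Adj a b)
    where
    SameClass⇒C12Adj : ∀ a b → SameClass isInj₁ a b → C12Adj sink a b
    SameClass⇒C12Adj (inj₁ i) (inj₁ j) (a≢b , _) = common-target⇒C12Adj sink {w = inj₂ zero} a≢b refl refl
    SameClass⇒C12Adj (inj₂ zero) (inj₂ zero) (a≢b , _) = contradiction refl a≢b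
    SameClass⇒C12Adj (inj₁ _) (inj₂ _) (_ , ())
    SameClass⇒C12Adj (inj₂ _) (inj₁ _) (_ , ())

KmK1-realizable : ∀ m → 1 ≤ m → Realizable (Fin m ⊎ Fin 1) (KmKnAdj m 1)
KmK1-realizable m 1≤m = realizable-if-C12Adj-is-SameClass 1≤m (s≤s z≤n) sink isInj₁
  ↔-refl (λ _ → refl) C12Adj⇔SameClass
  where open Sink m

-- Part 1 is {a₀, a₁} = {zero, suc zero}; a part-2 vertex b is beaten by the a-vertex of
-- colour c b and beats the other one, i.e. a₁ → c⁻¹(true) → a₀ → c⁻¹(false) → a₁.
module Cyclic {q : ℕ} (c : Fin q → Bool) where

  cyclic : Orientation 2 q
  cyclic zero       b = not (c b)
  cyclic (suc zero) b = c b

  colour : BVert 2 q → Bool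
  colour (inj₁ zero)       = false
  colour (inj₁ (suc zero)) = true
  colour (inj₂ b)          = c b

  colour-injective-on-part₁ : ∀ {i j} → colour (inj₁ i) ≡ colour (inj₁ j) → i ≡ j
  colour-injective-on-part₁ {zero}     {zero}     _ = refl
  colour-injective-on-part₁ {suc zero} {suc zero} _ = refl
  colour-injective-on-part₁ {zero}     {suc zero} ()
  colour-injective-on-part₁ {suc zero} {zero}     ()

  arc-from-part₁-keeps-colour : ∀ {i w} → Arc cyclic (inj₁ i) w → colour w ≡ colour (inj₁ i)
  arc-from-part₁-keeps-colour {zero}     {inj₂ _} a₀b = not-injective a₀b
  arc-from-part₁-keeps-colour {suc zero} {inj₂ _} a₁b = a₁b

  arc-from-part₂-flips-colour : ∀ {b w} → Arc cyclic (inj₂ b) w → colour w ≡ not (c b)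
  arc-from-part₂-flips-colour {_} {inj₁ zero}       ba₀ = sym ba₀
  arc-from-part₂-flips-colour {_} {inj₁ (suc zero)} ba₁ = cong not (sym ba₁)

  arc-into-part₂-keeps-colour : ∀ {a b} → Arc cyclic a (inj₂ b) → c b ≡ colour a
  arc-into-part₂-keeps-colour {inj₁ i} = arc-from-part₁-keeps-colour {i}
  arc-into-part₂-keeps-colour {inj₂ _} ()

  common-target⇒same-colour : ∀ {x y w} → Arc cyclic x w → Arc cyclic y w → colour x ≡ colour y
  common-target⇒same-colour {inj₁ _} {inj₁ _} xw yw =
    trans (sym (arc-from-part₁-keeps-colour xw)) (arc-from-part₁-keeps-colour yw)
  common-target⇒same-colour {inj₂ _} {inj₂ _} xw yw =
    not-injective (trans (sym (arc-from-part₂-flips-colour xw)) (arc-from-part₂-flips-colour yw))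
  common-target⇒same-colour {inj₁ _} {inj₂ _} {inj₁ _} ()
  common-target⇒same-colour {inj₁ _} {inj₂ _} {inj₂ _} _ ()
  common-target⇒same-colour {inj₂ _} {inj₁ _} {inj₁ _} _ ()
  common-target⇒same-colour {inj₂ _} {inj₁ _} {inj₂ _} ()

  competitors-same-colour : ∀ {x y w} → Arc cyclic x w → Dist≤2Avoid cyclic x y w → colour x ≡ colour y
  competitors-same-colour xw (inj₁ yw) = common-target⇒same-colour xw yw
  competitors-same-colour xw (inj₂ (inj₂ _ , _ , yz , zw)) =
    trans (common-target⇒same-colour xw zw) (arc-into-part₂-keeps-colour yz)
  competitors-same-colour {inj₁ _} xw (inj₂ (inj₁ _ , z≢x , _ , zw)) =
    contradiction (cong inj₁ (colour-injective-on-part₁ (common-target⇒same-colour zw xw))) z≢x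
  competitors-same-colour {inj₂ _} {w = inj₁ _} _ (inj₂ (inj₁ _ , _ , _ , ()))

  C12Adj⇒same-colour : ∀ {x y} → C12Adj cyclic x y → colour x ≡ colour y
  C12Adj⇒same-colour (_ , _ , _ , _ , inj₁ (xw , y↝w)) = competitors-same-colour xw y↝w
  C12Adj⇒same-colour (_ , _ , _ , _ , inj₂ (yw , x↝w)) = sym (competitors-same-colour yw x↝w)

  module _ (partnered : ∀ b → ∃[ b′ ] (b′ ≢ b × c b′ ≡ c b)) where

    across-same-colour⇒C12Adj : ∀ i b → SameClass colour (inj₁ i) (inj₂ b) → C12Adj cyclic (inj₁ i) (inj₂ b)
    across-same-colour⇒C12Adj zero b (x≢y , 0≡cb) with b′ , b′≢b , cb′≡cb ← partnered b =
      C12Adj-sym cyclic (two-step⇒C12Adj cyclic {w = inj₁ (suc zero)} (x≢y ∘ sym) (sym 0≡cb)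
        (b′≢b ∘ inj₂-injective) (cong not (trans cb′≡cb (sym 0≡cb))) (trans cb′≡cb (sym 0≡cb)))
    across-same-colour⇒C12Adj (suc zero) b (x≢y , 1≡cb) with b′ , b′≢b , cb′≡cb ← partnered b =
      C12Adj-sym cyclic (two-step⇒C12Adj cyclic {w = inj₁ zero} (x≢y ∘ sym) (cong not (sym 1≡cb))
        (b′≢b ∘ inj₂-injective) (trans cb′≡cb (sym 1≡cb)) (cong not (trans cb′≡cb (sym 1≡cb))))

    same-colour⇒C12Adj : ∀ x y → SameClass colour x y → C12Adj cyclic x y
    same-colour⇒C12Adj (inj₁ i) (inj₁ j) (x≢y , i∼j) =
      contradiction (cong inj₁ (colour-injective-on-part₁ i∼j)) x≢y
    same-colour⇒C12Adj (inj₁ i) (inj₂ b) i∼b = across-same-colour⇒C12Adj i b i∼b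
    same-colour⇒C12Adj (inj₂ b) (inj₁ i) (x≢y , cb≡i) =
      C12Adj-sym cyclic (across-same-colour⇒C12Adj i b (x≢y ∘ sym , sym cb≡i))
    same-colour⇒C12Adj (inj₂ b) (inj₂ b′) (x≢y , cb≡cb′) with c b in cb≡
    ... | true  = common-target⇒C12Adj cyclic {w = inj₁ zero} x≢y (cong not cb≡) (cong not (sym cb≡cb′))
    ... | false = common-target⇒C12Adj cyclic {w = inj₁ (suc zero)} x≢y cb≡ (sym cb≡cb′)

    C12Adj⇔SameClass : ∀ x y → C12Adj cyclic x y ⇔ SameClass colour x y
    C12Adj⇔SameClass x y = mk⇔ (λ xy → proj₁ xy , C12Adj⇒same-colour xy) (same-colour⇒C12Adj x y)

KmKn-realizable-from-3 : ∀ s t → Realizable (Fin (3 + s) ⊎ Fin (3 + t)) (KmKnAdj (3 + s) (3 + t))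
KmKn-realizable-from-3 s t = realizable-if-C12Adj-is-SameClass (s≤s z≤n) (s≤s z≤n)
  cyclic colour blocks colour∘to≗isInj₁ (C12Adj⇔SameClass partnered)
  where
  S T : ℕ
  S = 2 + s
  T = 2 + t

  c : Fin (S + T) → Bool
  c = isInj₁ ∘ splitAt S

  open Cyclic c

  partnered : ∀ b → ∃[ b′ ] (b′ ≢ b × c b′ ≡ c b)
  partnered b with splitAt S b in b≡
  ... | inj₁ i = partner i ↑ˡ T ,
        (λ e → partner-≢ i (↑ˡ-injective T _ _ (trans e (sym (splitAt⁻¹-↑ˡ b≡))))) ,
        cong isInj₁ (splitAt-↑ˡ S (partner i) T)
  ... | inj₂ j = S ↑ʳ partner j ,
        (λ e → partner-≢ j (↑ʳ-injective S _ _ (trans e (sym (splitAt⁻¹-↑ʳ b≡))))) ,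
        cong isInj₁ (splitAt-↑ʳ S T (partner j))

  to : Fin (3 + s) ⊎ Fin (3 + t) → BVert 2 (S + T)
  to (inj₁ zero)    = inj₁ (suc zero)
  to (inj₁ (suc i)) = inj₂ (i ↑ˡ T)
  to (inj₂ zero)    = inj₁ zero
  to (inj₂ (suc j)) = inj₂ (S ↑ʳ j)

  from : BVert 2 (S + T) → Fin (3 + s) ⊎ Fin (3 + t)
  from (inj₁ zero)       = inj₂ zero
  from (inj₁ (suc zero)) = inj₁ zero
  from (inj₂ b)          = Sum.map suc suc (splitAt S b)

  to∘from : ∀ a → to (from a) ≡ a
  to∘from (inj₁ zero)       = refl
  to∘from (inj₁ (suc zero)) = refl
  to∘from (inj₂ b) with splitAt S b in b≡
  ... | inj₁ i = cong inj₂ (splitAt⁻¹-↑ˡ b≡)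
  ... | inj₂ j = cong inj₂ (splitAt⁻¹-↑ʳ b≡)

  from∘to : ∀ x → from (to x) ≡ x
  from∘to (inj₁ zero)    = refl
  from∘to (inj₁ (suc i)) = cong (Sum.map suc suc) (splitAt-↑ˡ S i T)
  from∘to (inj₂ zero)    = refl
  from∘to (inj₂ (suc j)) = cong (Sum.map suc suc) (splitAt-↑ʳ S T j)

  blocks : (Fin (3 + s) ⊎ Fin (3 + t)) ↔ BVert 2 (S + T)
  blocks = mk↔ₛ′ to from to∘from from∘to

  colour∘to≗isInj₁ : ∀ x → colour (to x) ≡ isInj₁ x
  colour∘to≗isInj₁ (inj₁ zero)    = refl
  colour∘to≗isInj₁ (inj₁ (suc i)) = cong isInj₁ (splitAt-↑ˡ S i T)
  colour∘to≗isInj₁ (inj₂ zero)    = refl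
  colour∘to≗isInj₁ (inj₂ (suc j)) = cong isInj₁ (splitAt-↑ʳ S T j)

KmKn-realizable-if-≢2 : ∀ m n → 1 ≤ n → n ≤ m → n ≢ 2 → Realizable (Fin m ⊎ Fin n) (KmKnAdj m n)
KmKn-realizable-if-≢2 m 1 _ 1≤m _ = KmK1-realizable m 1≤m
KmKn-realizable-if-≢2 m 2 _ _ n≢2 = contradiction refl n≢2
KmKn-realizable-if-≢2 (suc (suc (suc s))) (suc (suc (suc t))) _ _ _ = KmKn-realizable-from-3 s t
KmKn-realizable-if-≢2 1 (suc (suc (suc _))) _ (s≤s ()) _
KmKn-realizable-if-≢2 2 (suc (suc (suc _))) _ (s≤s (s≤s ())) _

proposition3p1 : (m n : ℕ) → 1 ≤ n → n ≤ m →
    Realizable (Fin m ⊎ Fin n) (KmKnAdj m n) ⇔ (n ≢ 2)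
proposition3p1 m n 1≤n n≤m = mk⇔ (realizable⇒≢2 n≤m) (KmKn-realizable-if-≢2 m n 1≤n n≤m)
  where
  realizable⇒≢2 : ∀ {n} → n ≤ m → Realizable (Fin m ⊎ Fin n) (KmKnAdj m n) → n ≢ 2
  realizable⇒≢2 2≤m realizable refl = KmK2-unrealizable m 2≤m realizable
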